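{- Let $\mathcal{R}$ be the set of all colorings $\varphi:[\mathbb{N}]^2\to\{0,1\}$ that are reconstructible. Then $\mathcal{R}$ is a dense $G_\delta$ subset of $2^{[\mathbb{N}]^2}$ (with the product topology).
   Context: A coloring on a set $X$ is a function $\varphi:[X]^2\to\{0,1\}$, where $[X]^2$ is the set of $2$-element subsets of $X$. Let $\mathrm{hom}(\varphi)=\{H\subseteq X:\ |H|>2 \text{ and } \varphi \text{ is constant on } [H]^2\}$. The coloring $1-\varphi$ is defined by $(1-\varphi)(e)=1-\varphi(e)$. A coloring $\varphi$ on $X$ is reconstructible if for every coloring $\psi$ on $X$ with $\mathrm{hom}(\psi)=\mathrm{hom}(\varphi)$ one has $\psi=\varphi$ or $\psi=1-\varphi$. -}

module Defs where

open import Level using (0ℓ)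
open import Data.Nat using (ℕ; _<_)
open import Data.Fin using (Fin; toℕ)
open import Data.Bool using (Bool; true; not)
open import Data.Product using (Σ; ∃; _×_)
open import Data.Sum using (_⊎_)
open import Function.Bundles using (_⇔_)
open import Relation.Binary.PropositionalEquality using (_≡_)

-- [ℕ]² is encoded as pairs (j , i) with i < j, i.e. j : ℕ and i : Fin j.
-- A coloring φ : [ℕ]² → {0,1} is thus an element of the Cantor space 2^{[ℕ]²}.
Coloring : Set
Coloring = (j : ℕ) → Fin j → Bool

complement : Coloring → Coloring
complement φ j i = not (φ j i)

_≈c_ : Coloring → Coloring → Set
ψ ≈c φ = ∀ (j : ℕ) (i : Fin j) → ψ j i ≡ φ j i

-- subsets of ℕ (characteristic functions)
Subset : Set
Subset = ℕ → Bool

_∈_ : ℕ → Subset → Set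
n ∈ H = H n ≡ true

HasMoreThanTwo : Subset → Set
HasMoreThanTwo H = ∃ λ a → ∃ λ b → ∃ λ c → a < b × b < c × a ∈ H × b ∈ H × c ∈ H

ConstantOn : Coloring → Subset → Set
ConstantOn φ H = ∃ λ (c : Bool) → ∀ (j : ℕ) (i : Fin j) → toℕ i ∈ H → j ∈ H → φ j i ≡ c

Hom : Coloring → Subset → Set
Hom φ H = HasMoreThanTwo H × ConstantOn φ H

Reconstructible : Coloring → Set
Reconstructible φ =
  ∀ (ψ : Coloring) → (∀ (H : Subset) → Hom ψ H ⇔ Hom φ H) → (ψ ≈c φ) ⊎ (ψ ≈c complement φ)

-- Product topology on 2^{[ℕ]²}.
-- A basic open cylinder is given by N and a prescription of colors on all edges {i,j} with i < j < N.
Prefix : ℕ → Set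
Prefix N = (j : Fin N) → Fin (toℕ j) → Bool

Cyl : (N : ℕ) → Prefix N → Coloring → Set
Cyl N s φ = ∀ (j : Fin N) (i : Fin (toℕ j)) → φ (toℕ j) i ≡ s j i

-- An open set is a union of basic cylinders, coded by the family of cylinder codes it contains.
OpenCode : Set₁
OpenCode = (N : ℕ) → Prefix N → Set

InOpen : OpenCode → Coloring → Set
InOpen U φ = ∃ λ N → ∃ λ (s : Prefix N) → U N s × Cyl N s φ

IsGδ : (Coloring → Set) → Set₁
IsGδ R = Σ (ℕ → OpenCode) λ U → ∀ (φ : Coloring) → R φ ⇔ (∀ (n : ℕ) → InOpen (U n) φ)

IsDense : (Coloring → Set) → Set
IsDense R = ∀ (N : ℕ) (s : Prefix N) → ∃ λ φ → Cyl N s φ × R φ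

-- Two colorings have the same homogeneous sets iff they have the same monochromatic triangles.
-- Density: beyond any finite prefix add two vertices all of whose edges have color 0 and two more
-- whose remaining edges have color 1. A coloring ψ with the same monochromatic triangles is then
-- constant on the 0-edges (triangles through the first pair) and on the 1-edges (triangles through
-- the second pair), and the two constants differ because a vertex of the first pair together with
-- the second pair spans a triangle that is not monochromatic.
-- Gδ: after complementing, a rival ψ ≠ φ with the same monochromatic triangles agrees with φ on
-- {0, 1} and differs from it in some row j. By König's lemma, φ has no such rival for row j iff for
-- some M no coloring matches φ's monochromatic triangles below M while doing so, and that is an
-- open condition on φ.

module Submission where

open import Defs
open import Level using (0ℓ)
open import Data.Product using (_×_)
open import Axiom.ExcludedMiddle using (ExcludedMiddle)

open import Axiom.DoubleNegationElimination using (em⇒dne)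
open import Data.Bool using (Bool; true; false; not; _∨_; _xor_)
import Data.Bool as Bool
open import Data.Bool.Properties using (¬-not; not-¬; not-involutive; not-injective; xor-identityʳ; xor-comm)
open import Data.Empty using (⊥-elim)
open import Data.Fin using (Fin; zero; suc; toℕ; fromℕ<; cast)
open import Data.Fin.Properties using (toℕ<n; toℕ-fromℕ<; fromℕ<-toℕ; cast-is-id)
open import Data.Nat using (ℕ; zero; suc; _+_; _∸_; _⊔_; _<_; _≤_; _≟_; _<?_; z≤n; s≤s)
open import Data.Nat.Properties
  using (<-cmp; <-asym; ≤-trans; <-≤-trans; <⇒≤; <⇒≢; ≤⇒≯; ≮⇒≥; ≤∧≮⇒≡; n≤1+n; m≤m+n; m≤n+m;
         m≤m⊔n; m≤n⊔m; m+n≮n; m+n∸n≡m; +-cancelʳ-≡; m<1+n⇒m<n∨m≡n)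
open import Data.Product using (Σ; ∃; _,_; proj₁; proj₂)
open import Data.Sum using (_⊎_; inj₁; inj₂)
open import Data.Unit using (⊤; tt)
open import Function using (case_of_)
open import Function.Bundles using (_⇔_; mk⇔; Equivalence)
import Function.Properties.Equivalence as ⇔
open import Relation.Binary.Definitions using (tri<; tri≈; tri>)
open import Relation.Binary.PropositionalEquality
  using (_≡_; _≢_; refl; sym; trans; cong; subst; ≢-sym; module ≡-Reasoning)
open import Relation.Nullary using (¬_; Dec; yes; no; contradiction)
open import Relation.Nullary.Decidable using (⌊_⌋)

open Equivalence using (to; from)

≮∧≯⇒≡ : ∀ {u v} → ¬ u < v → ¬ v < u → u ≡ v
≮∧≯⇒≡ u≮v v≮u = ≤∧≮⇒≡ (≮⇒≥ v≮u) u≮v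

AgreeBelow : ℕ → Coloring → Coloring → Set
AgreeBelow L χ χ′ = ∀ {j} → j < L → (i : Fin j) → χ j i ≡ χ′ j i

-- Junk value false on the diagonal u ≡ v.
edge : Coloring → ℕ → ℕ → Bool
edge χ u v with u <? v | v <? u
... | yes u<v | _ = χ v (fromℕ< u<v)
... | no _ | yes v<u = χ u (fromℕ< v<u)
... | no _ | no _ = false

edge-sym : ∀ χ u v → edge χ u v ≡ edge χ v u
edge-sym χ u v with u <? v | v <? u
... | yes u<v | yes v<u = ⊥-elim (<-asym u<v v<u)
... | yes _ | no _ = refl
... | no _ | yes _ = refl
... | no _ | no _ = refl

edge-toℕ : ∀ χ {j} (i : Fin j) → edge χ (toℕ i) j ≡ χ j i
edge-toℕ χ {j} i with toℕ i <? j
... | yes i<j = cong (χ j) (fromℕ<-toℕ i i<j)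
... | no i≮j = contradiction (toℕ<n i) i≮j

edge-complement : ∀ χ {u v} → u ≢ v → edge (complement χ) u v ≡ not (edge χ u v)
edge-complement χ {u} {v} u≢v with u <? v | v <? u
... | yes _ | _ = refl
... | no _ | yes _ = refl
... | no u≮v | no v≮u = contradiction (≮∧≯⇒≡ u≮v v≮u) u≢v

edge-agree : ∀ {L χ χ′ u v} → AgreeBelow L χ χ′ → u < L → v < L → edge χ u v ≡ edge χ′ u v
edge-agree {u = u} {v} agree u<L v<L with u <? v | v <? u
... | yes _ | _ = agree v<L _
... | no _ | yes _ = agree u<L _
... | no _ | no _ = refl

Distinct : ℕ → ℕ → ℕ → Set
Distinct a b c = a ≢ b × a ≢ c × b ≢ c

Monochromatic : Coloring → ℕ → ℕ → ℕ → Set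
Monochromatic χ a b c = edge χ a b ≡ edge χ a c × edge χ a b ≡ edge χ b c

monochromatic : ∀ {χ a b c k} → edge χ a b ≡ k → edge χ a c ≡ k → edge χ b c ≡ k →
                Monochromatic χ a b c
monochromatic ab ac bc = trans ab (sym ac) , trans ab (sym bc)

monochromatic-complement : ∀ {χ a b c} → Distinct a b c →
                           Monochromatic (complement χ) a b c ⇔ Monochromatic χ a b c
monochromatic-complement {χ} (a≢b , a≢c , b≢c) = mk⇔
  (λ (ab≡ac , ab≡bc) → not-injective (trans (sym ab) (trans ab≡ac ac)) ,
                       not-injective (trans (sym ab) (trans ab≡bc bc)))
  (λ (ab≡ac , ab≡bc) → trans ab (trans (cong not ab≡ac) (sym ac)) ,
                       trans ab (trans (cong not ab≡bc) (sym bc)))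
  where
  ab = edge-complement χ a≢b
  ac = edge-complement χ a≢c
  bc = edge-complement χ b≢c

monochromatic-agree : ∀ {L χ χ′ a b c} → AgreeBelow L χ χ′ → a < L → b < L → c < L →
                      Monochromatic χ a b c ⇔ Monochromatic χ′ a b c
monochromatic-agree agree a<L b<L c<L = mk⇔
  (λ (ab≡ac , ab≡bc) → trans (sym ab) (trans ab≡ac ac) , trans (sym ab) (trans ab≡bc bc))
  (λ (ab≡ac , ab≡bc) → trans ab (trans ab≡ac (sym ac)) , trans ab (trans ab≡bc (sym bc)))
  where
  ab = edge-agree agree a<L b<L
  ac = edge-agree agree a<L c<L
  bc = edge-agree agree b<L c<L

edge-constantOn : ∀ {χ H} (const : ConstantOn χ H) {u v} → u ∈ H → v ∈ H → u ≢ v →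
                  edge χ u v ≡ proj₁ const
edge-constantOn {H = H} (_ , const) {u} {v} u∈H v∈H u≢v with u <? v | v <? u
... | yes u<v | _ = const v _ (subst (_∈ H) (sym (toℕ-fromℕ< u<v)) u∈H) v∈H
... | no _ | yes v<u = const u _ (subst (_∈ H) (sym (toℕ-fromℕ< v<u)) v∈H) u∈H
... | no u≮v | no v≮u = contradiction (≮∧≯⇒≡ u≮v v≮u) u≢v

constantOn-fromEdges : ∀ {χ H} k → (∀ {u v} → u ∈ H → v ∈ H → u ≢ v → edge χ u v ≡ k) →
                       ConstantOn χ H
constantOn-fromEdges {χ} k edges =
  k , λ j i i∈H j∈H → trans (sym (edge-toℕ χ i)) (edges i∈H j∈H (<⇒≢ (toℕ<n i)))

monochromatic-constantOn : ∀ {χ H a b c} → ConstantOn χ H → a ∈ H → b ∈ H → c ∈ H →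
                           Distinct a b c → Monochromatic χ a b c
monochromatic-constantOn {χ} {a = a} {b} {c} const a∈H b∈H c∈H (a≢b , a≢c , b≢c) =
  monochromatic {χ} {a} {b} {c} (edge-constantOn {χ} const a∈H b∈H a≢b)
    (edge-constantOn const a∈H c∈H a≢c) (edge-constantOn const b∈H c∈H b≢c)

-- Any two edges inside H are linked through edges sharing a vertex with them and with {a, b}.
constantOn-fromAdjacentEdges :
  ∀ {χ H} → HasMoreThanTwo H →
  (∀ {p q r} → p ∈ H → q ∈ H → r ∈ H → Distinct p q r → edge χ p q ≡ edge χ p r) →
  ConstantOn χ H
constantOn-fromAdjacentEdges {χ} {H} (a , b , _ , a<b , _ , a∈H , b∈H , _) adjacent =
  constantOn-fromEdges (edge χ a b) edges
  where
  a≢b = <⇒≢ a<b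

  fromA : ∀ {v} → v ∈ H → a ≢ v → edge χ a v ≡ edge χ a b
  fromA {v} v∈H a≢v with v ≟ b
  ... | yes refl = refl
  ... | no v≢b = adjacent {a} {v} {b} a∈H v∈H b∈H (a≢v , a≢b , v≢b)

  edges : ∀ {u v} → u ∈ H → v ∈ H → u ≢ v → edge χ u v ≡ edge χ a b
  edges {u} {v} u∈H v∈H u≢v with u ≟ a
  ... | yes refl = fromA v∈H u≢v
  ... | no u≢a = trans toA (trans (edge-sym χ u a) (fromA u∈H (≢-sym u≢a)))
    where
    toA : edge χ u v ≡ edge χ u a
    toA with v ≟ a
    ... | yes refl = refl
    ... | no v≢a = adjacent {u} {v} {a} u∈H v∈H a∈H (u≢v , u≢a , v≢a)

hom-transfer : ∀ {ψ φ} →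
               (∀ {a b c} → Distinct a b c → Monochromatic ψ a b c → Monochromatic φ a b c) →
               ∀ {H} → Hom ψ H → Hom φ H
hom-transfer preserve (big , const) =
  big , constantOn-fromAdjacentEdges big λ p∈H q∈H r∈H d →
          proj₁ (preserve d (monochromatic-constantOn const p∈H q∈H r∈H d))

triangle : ℕ → ℕ → ℕ → Subset
triangle a b c n = ⌊ n ≟ a ⌋ ∨ ⌊ n ≟ b ⌋ ∨ ⌊ n ≟ c ⌋

∈-triangle⁻ : ∀ {a b c} n → n ∈ triangle a b c → n ≡ a ⊎ n ≡ b ⊎ n ≡ c
∈-triangle⁻ {a} {b} {c} n n∈T with n ≟ a | n ≟ b | n ≟ c
... | yes n≡a | _ | _ = inj₁ n≡a
... | no _ | yes n≡b | _ = inj₂ (inj₁ n≡b)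
... | no _ | no _ | yes n≡c = inj₂ (inj₂ n≡c)
∈-triangle⁻ n () | no _ | no _ | no _

a∈triangle : ∀ a b c → a ∈ triangle a b c
a∈triangle a b c with a ≟ a
... | yes _ = refl
... | no a≢a = contradiction refl a≢a

b∈triangle : ∀ a b c → b ∈ triangle a b c
b∈triangle a b c with b ≟ a | b ≟ b
... | yes _ | _ = refl
... | no _ | yes _ = refl
... | no _ | no b≢b = contradiction refl b≢b

c∈triangle : ∀ a b c → c ∈ triangle a b c
c∈triangle a b c with c ≟ a | c ≟ b | c ≟ c
... | yes _ | _ | _ = refl
... | no _ | yes _ | _ = refl
... | no _ | no _ | yes _ = refl
... | no _ | no _ | no c≢c = contradiction refl c≢c

hasMoreThanTwo : ∀ {H x y z} → x ∈ H → y ∈ H → z ∈ H → Distinct x y z → HasMoreThanTwo H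
hasMoreThanTwo {x = x} {y} {z} x∈H y∈H z∈H (x≢y , x≢z , y≢z)
  with <-cmp x y | <-cmp y z | <-cmp x z
... | tri≈ _ x≡y _ | _ | _ = contradiction x≡y x≢y
... | _ | tri≈ _ y≡z _ | _ = contradiction y≡z y≢z
... | _ | _ | tri≈ _ x≡z _ = contradiction x≡z x≢z
... | tri< x<y _ _ | tri< y<z _ _ | _ = x , y , z , x<y , y<z , x∈H , y∈H , z∈H
... | tri< x<y _ _ | tri> _ _ z<y | tri< x<z _ _ = x , z , y , x<z , z<y , x∈H , z∈H , y∈H
... | tri< x<y _ _ | tri> _ _ z<y | tri> _ _ z<x = z , x , y , z<x , x<y , z∈H , x∈H , y∈H
... | tri> _ _ y<x | tri< y<z _ _ | tri< x<z _ _ = y , x , z , y<x , x<z , y∈H , x∈H , z∈H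
... | tri> _ _ y<x | tri< y<z _ _ | tri> _ _ z<x = y , z , x , y<z , z<x , y∈H , z∈H , x∈H
... | tri> _ _ y<x | tri> _ _ z<y | _ = z , y , x , z<y , y<x , z∈H , y∈H , x∈H

hom-triangle⇔monochromatic : ∀ {χ a b c} → Distinct a b c →
                             Hom χ (triangle a b c) ⇔ Monochromatic χ a b c
hom-triangle⇔monochromatic {χ} {a} {b} {c} d = mk⇔
  (λ (_ , const) → monochromatic-constantOn const (a∈triangle a b c) (b∈triangle a b c)
                                              (c∈triangle a b c) d)
  (λ mono → hasMoreThanTwo (a∈triangle a b c) (b∈triangle a b c) (c∈triangle a b c) d ,
            constantOn-fromEdges (edge χ a b) λ {u} {v} u∈T v∈T u≢v →
              edges mono (∈-triangle⁻ u u∈T) (∈-triangle⁻ v v∈T) u≢v)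
  where
  edges : ∀ {u v} → Monochromatic χ a b c → u ≡ a ⊎ u ≡ b ⊎ u ≡ c → v ≡ a ⊎ v ≡ b ⊎ v ≡ c →
          u ≢ v → edge χ u v ≡ edge χ a b
  edges _ (inj₁ refl) (inj₁ refl) u≢v = contradiction refl u≢v
  edges _ (inj₁ refl) (inj₂ (inj₁ refl)) _ = refl
  edges (ab≡ac , _) (inj₁ refl) (inj₂ (inj₂ refl)) _ = sym ab≡ac
  edges _ (inj₂ (inj₁ refl)) (inj₁ refl) _ = edge-sym χ b a
  edges _ (inj₂ (inj₁ refl)) (inj₂ (inj₁ refl)) u≢v = contradiction refl u≢v
  edges (_ , ab≡bc) (inj₂ (inj₁ refl)) (inj₂ (inj₂ refl)) _ = sym ab≡bc
  edges (ab≡ac , _) (inj₂ (inj₂ refl)) (inj₁ refl) _ = trans (edge-sym χ c a) (sym ab≡ac)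
  edges (_ , ab≡bc) (inj₂ (inj₂ refl)) (inj₂ (inj₁ refl)) _ = trans (edge-sym χ c b) (sym ab≡bc)
  edges _ (inj₂ (inj₂ refl)) (inj₂ (inj₂ refl)) u≢v = contradiction refl u≢v

SameMonoTriangles : Coloring → Coloring → Set
SameMonoTriangles ψ φ = ∀ {a b c} → Distinct a b c → Monochromatic ψ a b c ⇔ Monochromatic φ a b c

sameHom⇔sameMonoTriangles : ∀ {ψ φ} → (∀ H → Hom ψ H ⇔ Hom φ H) ⇔ SameMonoTriangles ψ φ
sameHom⇔sameMonoTriangles {ψ} {φ} = mk⇔
  (λ sameHom {a} {b} {c} d →
     ⇔.trans (⇔.sym (hom-triangle⇔monochromatic {ψ} d))
             (⇔.trans (sameHom (triangle a b c)) (hom-triangle⇔monochromatic d)))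
  (λ same H → mk⇔ (hom-transfer λ d → to (same d)) (hom-transfer λ d → from (same d)))

SameMonoTrianglesBelow : ℕ → Coloring → Coloring → Set
SameMonoTrianglesBelow M ψ φ =
  ∀ {a b c} → a < M → b < M → c < M → Distinct a b c →
  Monochromatic ψ a b c ⇔ Monochromatic φ a b c

sameMonoTriangles-fromBelow : ∀ {ψ φ} → (∀ M → SameMonoTrianglesBelow M ψ φ) →
                              SameMonoTriangles ψ φ
sameMonoTriangles-fromBelow below {a} {b} {c} =
  below (suc (a ⊔ b ⊔ c)) (s≤s (≤-trans (m≤m⊔n a b) (m≤m⊔n _ c)))
                          (s≤s (≤-trans (m≤n⊔m a b) (m≤m⊔n _ c))) (s≤s (m≤n⊔m _ c))

-- Every third vertex of P forms a monochromatic φ-triangle with z and z′.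
twins-force : ∀ {ψ φ} → SameMonoTriangles ψ φ → (P : ℕ → Set) {z z′ : ℕ} {c : Bool} →
              P z′ → z ≢ z′ →
              (∀ {x} → P x → x ≢ z → edge φ z x ≡ c) → (∀ {x} → P x → x ≢ z′ → edge φ z′ x ≡ c) →
              ∀ {u v} → P u → P v → u ≢ v → edge φ u v ≡ c → edge ψ u v ≡ edge ψ z z′
twins-force {ψ} {φ} same P {z} {z′} {c} Pz′ z≢z′ from-z from-z′ = force
  where
  to-z : ∀ {x} → P x → x ≢ z → edge φ x z ≡ c
  to-z {x} Px x≢z = trans (edge-sym φ x z) (from-z Px x≢z)

  ψ-to-z : ∀ {x} → P x → x ≢ z → edge ψ x z ≡ edge ψ z z′
  ψ-to-z {x} Px x≢z with x ≟ z′
  ... | yes refl = edge-sym ψ z′ z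
  ... | no x≢z′ = proj₂ (from (same (x≢z , x≢z′ , z≢z′)) mono)
    where
    mono = monochromatic {φ} {x} {z} {z′} (to-z Px x≢z)
             (trans (edge-sym φ x z′) (from-z′ Px x≢z′)) (from-z Pz′ (≢-sym z≢z′))

  force : ∀ {u v} → P u → P v → u ≢ v → edge φ u v ≡ c → edge ψ u v ≡ edge ψ z z′
  force {u} {v} Pu Pv u≢v uv with u ≟ z | v ≟ z
  ... | yes refl | _ = trans (edge-sym ψ z v) (ψ-to-z Pv (≢-sym u≢v))
  ... | no _ | yes refl = ψ-to-z Pu u≢v
  ... | no u≢z | no v≢z = trans (proj₁ (from (same (u≢v , u≢z , v≢z)) mono)) (ψ-to-z Pu u≢z)
    where
    mono = monochromatic {φ} {u} {v} {z} uv (to-z Pu u≢z) (to-z Pv v≢z)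

xor-dichotomy : ∀ {ψ φ} b → (∀ j i → ψ j i ≡ b xor φ j i) → ψ ≈c φ ⊎ ψ ≈c complement φ
xor-dichotomy false same = inj₁ same
xor-dichotomy true flipped = inj₂ flipped

withPrefix : (N : ℕ) → Prefix N → Coloring → Coloring
withPrefix N s χ j i with j <? N
... | yes j<N = s (fromℕ< j<N) (cast (sym (toℕ-fromℕ< j<N)) i)
... | no _ = χ j i

cyl-withPrefix : ∀ N s χ → Cyl N s (withPrefix N s χ)
cyl-withPrefix N s χ j i with toℕ j <? N
... | yes j<N = from-toℕ (fromℕ<-toℕ j j<N) _
  where
  from-toℕ : ∀ {k} → k ≡ j → .(e : toℕ j ≡ toℕ k) → s k (cast e i) ≡ s j i
  from-toℕ {k} refl e = cong (s k) (cast-is-id e i)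
... | no j≮N = contradiction (toℕ<n j) j≮N

withPrefix-above : ∀ {N s χ j} → N ≤ j → (i : Fin j) → withPrefix N s χ j i ≡ χ j i
withPrefix-above {N} {j = j} N≤j i with j <? N
... | yes j<N = contradiction j<N (≤⇒≯ N≤j)
... | no _ = refl

data Role : Set where
  zeroHub oneHub plain : Role

hubColor : Role → Role → Bool
hubColor zeroHub _ = false
hubColor _ zeroHub = false
hubColor oneHub _ = true
hubColor _ oneHub = true
hubColor plain plain = false

hubColor-sym : ∀ r r′ → hubColor r r′ ≡ hubColor r′ r
hubColor-sym zeroHub zeroHub = refl
hubColor-sym zeroHub oneHub = refl
hubColor-sym zeroHub plain = refl
hubColor-sym oneHub zeroHub = refl
hubColor-sym oneHub oneHub = refl
hubColor-sym oneHub plain = refl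
hubColor-sym plain zeroHub = refl
hubColor-sym plain oneHub = refl
hubColor-sym plain plain = refl

hubColor-oneHub : ∀ {r} → r ≢ zeroHub → hubColor oneHub r ≡ true
hubColor-oneHub {zeroHub} r≢zeroHub = contradiction refl r≢zeroHub
hubColor-oneHub {oneHub} _ = refl
hubColor-oneHub {plain} _ = refl

-- The vertices N, N+1 have only 0-edges and N+2, N+3 only 1-edges apart from those to N, N+1;
-- all remaining edges outside the prefix get color 0.
module Hub (N : ℕ) (s : Prefix N) where

  roleAt : ℕ → Role
  roleAt 0 = zeroHub
  roleAt 1 = zeroHub
  roleAt 2 = oneHub
  roleAt 3 = oneHub
  roleAt _ = plain

  role : ℕ → Role
  role x with x <? N
  ... | yes _ = plain
  ... | no _ = roleAt (x ∸ N)

  hub : Coloring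
  hub = withPrefix N s λ j i → hubColor (role (toℕ i)) (role j)

  role-offset : ∀ d → role (d + N) ≡ roleAt d
  role-offset d with d + N <? N
  ... | yes d+N<N = contradiction d+N<N (m+n≮n d N)
  ... | no _ = cong roleAt (m+n∸n≡m d N)

  special-above : ∀ {x} → role x ≢ plain → N ≤ x
  special-above {x} special = ≮⇒≥ below
    where
    below : ¬ x < N
    below x<N with x <? N
    ... | yes _ = special refl
    ... | no x≮N = x≮N x<N

  edge-hub : ∀ {u v} → role u ≢ plain → u ≢ v → edge hub u v ≡ hubColor (role u) (role v)
  edge-hub {u} {v} special u≢v with u <? v | v <? u
  ... | yes u<v | _ =
    trans (withPrefix-above (≤-trans (special-above special) (<⇒≤ u<v)) _)
          (cong (λ x → hubColor (role x) (role v)) (toℕ-fromℕ< u<v))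
  ... | no _ | yes v<u =
    trans (withPrefix-above (special-above special) _)
          (trans (cong (λ x → hubColor (role x) (role u)) (toℕ-fromℕ< v<u))
                 (hubColor-sym (role v) (role u)))
  ... | no u≮v | no v≮u = contradiction (≮∧≯⇒≡ u≮v v≮u) u≢v

  edge-zeroHub : ∀ {u v} → role u ≡ zeroHub → u ≢ v → edge hub u v ≡ false
  edge-zeroHub {u} {v} u-zero u≢v =
    trans (edge-hub (λ u-plain → case trans (sym u-zero) u-plain of λ ()) u≢v)
          (cong (λ r → hubColor r (role v)) u-zero)

  edge-oneHub : ∀ {u v} → role u ≡ oneHub → role v ≢ zeroHub → u ≢ v → edge hub u v ≡ true
  edge-oneHub {u} {v} u-one v-nonzero u≢v =
    trans (edge-hub (λ u-plain → case trans (sym u-one) u-plain of λ ()) u≢v)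
          (trans (cong (λ r → hubColor r (role v)) u-one) (hubColor-oneHub v-nonzero))

  z₀ z₁ w₀ w₁ : ℕ
  z₀ = 0 + N
  z₁ = 1 + N
  w₀ = 2 + N
  w₁ = 3 + N

  offsets-distinct : ∀ {d d′} → d ≢ d′ → d + N ≢ d′ + N
  offsets-distinct d≢d′ e = d≢d′ (+-cancelʳ-≡ N _ _ e)

  w₁-nonzero : role w₁ ≢ zeroHub
  w₁-nonzero w₁-zero = case trans (sym (role-offset 3)) w₁-zero of λ ()

  oneEdge-nonzero : ∀ {u v} → u ≢ v → edge hub u v ≡ true → role u ≢ zeroHub
  oneEdge-nonzero u≢v uv u-zero = case trans (sym uv) (edge-zeroHub u-zero u≢v) of λ ()

  hub-reconstructible : Reconstructible hub
  hub-reconstructible ψ sameHom = xor-dichotomy b colors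
    where
    same : SameMonoTriangles ψ hub
    same = to sameHom⇔sameMonoTriangles sameHom

    b : Bool
    b = edge ψ z₀ z₁

    zero-edges : ∀ {u v} → u ≢ v → edge hub u v ≡ false → edge ψ u v ≡ b
    zero-edges = twins-force same (λ _ → ⊤) tt (offsets-distinct λ ())
                   (λ _ x≢z₀ → edge-zeroHub (role-offset 0) (≢-sym x≢z₀))
                   (λ _ x≢z₁ → edge-zeroHub (role-offset 1) (≢-sym x≢z₁)) tt tt

    one-edges : ∀ {u v} → u ≢ v → edge hub u v ≡ true → edge ψ u v ≡ edge ψ w₀ w₁
    one-edges {u} {v} u≢v uv =
      twins-force same (λ x → role x ≢ zeroHub) w₁-nonzero (offsets-distinct λ ())
        (λ x-nonzero x≢w₀ → edge-oneHub (role-offset 2) x-nonzero (≢-sym x≢w₀))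
        (λ x-nonzero x≢w₁ → edge-oneHub (role-offset 3) x-nonzero (≢-sym x≢w₁))
        (oneEdge-nonzero u≢v uv) (oneEdge-nonzero (≢-sym u≢v) (trans (edge-sym hub v u) uv))
        u≢v uv

    -- {z₀, w₀, w₁} is not monochromatic for hub, so it cannot be for ψ.
    w-edge : edge ψ w₀ w₁ ≡ not b
    w-edge = ¬-not λ w₀w₁≡b →
      case trans (sym (edge-zeroHub (role-offset 0) z₀≢w₀))
                 (trans (proj₂ (to (same d) (mono w₀w₁≡b)))
                        (edge-oneHub (role-offset 2) w₁-nonzero (offsets-distinct λ ()))) of λ ()
      where
      z₀≢w₀ : z₀ ≢ w₀
      z₀≢w₀ = offsets-distinct λ ()
      z₀≢w₁ : z₀ ≢ w₁
      z₀≢w₁ = offsets-distinct λ ()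
      d : Distinct z₀ w₀ w₁
      d = z₀≢w₀ , z₀≢w₁ , offsets-distinct λ ()
      mono : edge ψ w₀ w₁ ≡ b → Monochromatic ψ z₀ w₀ w₁
      mono = monochromatic {ψ} {z₀} {w₀} {w₁}
               (zero-edges z₀≢w₀ (edge-zeroHub (role-offset 0) z₀≢w₀))
               (zero-edges z₀≢w₁ (edge-zeroHub (role-offset 0) z₀≢w₁))

    edges : ∀ {u v} → u ≢ v → edge ψ u v ≡ b xor edge hub u v
    edges {u} {v} u≢v with edge hub u v in uv
    ... | false = trans (zero-edges u≢v uv) (sym (xor-identityʳ b))
    ... | true = trans (one-edges u≢v uv) (trans w-edge (xor-comm true b))

    colors : ∀ j i → ψ j i ≡ b xor hub j i
    colors j i = begin
      ψ j i                      ≡⟨ edge-toℕ ψ i ⟨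
      edge ψ (toℕ i) j            ≡⟨ edges (<⇒≢ (toℕ<n i)) ⟩
      b xor edge hub (toℕ i) j    ≡⟨ cong (b xor_) (edge-toℕ hub i) ⟩
      b xor hub j i              ∎
      where open ≡-Reasoning

dense : IsDense Reconstructible
dense N s = Hub.hub N s , cyl-withPrefix N s _ , Hub.hub-reconstructible N s

-- Complementing ψ preserves its monochromatic triangles, so ψ may be assumed to agree with φ
-- on the edge {0, 1}.
ReconstructibleGiven01 : Coloring → Set
ReconstructibleGiven01 φ = ∀ ψ → SameMonoTriangles ψ φ → ψ 1 zero ≡ φ 1 zero → ψ ≈c φ

reconstructible⇔given01 : ∀ {φ} → Reconstructible φ ⇔ ReconstructibleGiven01 φ
reconstructible⇔given01 {φ} = mk⇔ given01 reconstructible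
  where
  given01 : Reconstructible φ → ReconstructibleGiven01 φ
  given01 rec ψ same pin with rec ψ (from sameHom⇔sameMonoTriangles same)
  ... | inj₁ ψ≈φ = ψ≈φ
  ... | inj₂ ψ≈φᶜ = contradiction (ψ≈φᶜ 1 zero) (not-¬ pin)

  reconstructible : ReconstructibleGiven01 φ → Reconstructible φ
  reconstructible given ψ sameHom = byPin (ψ 1 zero Bool.≟ φ 1 zero)
    where
    same = to sameHom⇔sameMonoTriangles sameHom

    byPin : Dec (ψ 1 zero ≡ φ 1 zero) → ψ ≈c φ ⊎ ψ ≈c complement φ
    byPin (yes pin) = inj₁ (given ψ same pin)
    byPin (no ¬pin) = inj₂ λ j i → trans (sym (not-involutive (ψ j i))) (cong not (ψᶜ≈φ j i))
      where
      ψᶜ≈φ : complement ψ ≈c φ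
      ψᶜ≈φ = given (complement ψ) (λ d → ⇔.trans (monochromatic-complement d) (same d))
                   (trans (cong not (¬-not ¬pin)) (not-involutive _))

¬∀⇒∃¬ : ExcludedMiddle 0ℓ → ∀ {A : Set} {P : A → Set} → ¬ (∀ x → P x) → ∃ λ x → ¬ P x
¬∀⇒∃¬ em ¬∀ = dne λ ¬∃ → ¬∀ λ x → dne λ ¬Px → ¬∃ (x , ¬Px)
  where
  dne = em⇒dne em

setRow : Coloring → (N : ℕ) → (Fin N → Bool) → Coloring
setRow ρ N r j i with j ≟ N
... | yes refl = r i
... | no _ = ρ j i

setRow-on : ∀ ρ N r i → setRow ρ N r N i ≡ r i
setRow-on ρ N r i with N ≟ N
... | yes refl = refl
... | no N≢N = contradiction refl N≢N

setRow-off : ∀ ρ N r {j} (i : Fin j) → j ≢ N → setRow ρ N r j i ≡ ρ j i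
setRow-off ρ N r {j} i j≢N with j ≟ N
... | yes j≡N = contradiction j≡N j≢N
... | no _ = refl

-- König's lemma for colorings: the bits of a common solution are fixed one at a time, each choice
-- keeping every C M satisfiable by a coloring that extends the bits fixed so far.
module Compactness (em : ExcludedMiddle 0ℓ) (C : ℕ → Coloring → Set)
  (antitone : ∀ {M M′ ψ} → M ≤ M′ → C M′ ψ → C M ψ)
  (local : ∀ M → ∃ λ L → ∀ {ψ ψ′} → AgreeBelow L ψ ψ′ → C M ψ → C M ψ′)
  where

  Satisfiable : (Coloring → Set) → Set
  Satisfiable P = ∀ M → ∃ λ ψ → P ψ × C M ψ

  weaken : ∀ {P Q : Coloring → Set} → (∀ {ψ} → P ψ → Q ψ) → Satisfiable P → Satisfiable Q
  weaken P⇒Q sat M with sat M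
  ... | ψ , Pψ , Cψ = ψ , P⇒Q Pψ , Cψ

  fix-bit : ∀ {P} (bit : Coloring → Bool) → Satisfiable P →
            ∃ λ b → Satisfiable (λ ψ → P ψ × bit ψ ≡ b)
  fix-bit {P} bit sat with em {Satisfiable (λ ψ → P ψ × bit ψ ≡ false)}
  ... | yes sat-false = false , sat-false
  ... | no unsat-false with ¬∀⇒∃¬ em unsat-false
  ...   | M₀ , none-at-M₀ = true , sat-true
    where
    sat-true : Satisfiable (λ ψ → P ψ × bit ψ ≡ true)
    sat-true M with sat (M + M₀)
    ... | ψ , Pψ , Cψ with bit ψ in bitψ
    ...   | true = ψ , (Pψ , bitψ) , antitone (m≤m+n M M₀) Cψ
    ...   | false = ⊥-elim (none-at-M₀ (ψ , (Pψ , bitψ) , antitone (m≤n+m M₀ M) Cψ))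

  fix-bits : ∀ {P} n (bit : Fin n → Coloring → Bool) → Satisfiable P →
             ∃ λ (r : Fin n → Bool) → Satisfiable (λ ψ → P ψ × ∀ i → bit i ψ ≡ r i)
  fix-bits zero bit sat = (λ ()) , weaken (λ Pψ → Pψ , λ ()) sat
  fix-bits (suc n) bit sat with fix-bit (bit zero) sat
  ... | b , sat₀ with fix-bits n (λ i → bit (suc i)) sat₀
  ...   | r , sat₁ =
    (λ { zero → b ; (suc i) → r i }) ,
    weaken (λ ((Pψ , bit₀) , bits) → Pψ , λ { zero → bit₀ ; (suc i) → bits i }) sat₁

  module _ (satisfiable : ∀ M → ∃ (C M)) where

    stage : ∀ N → Σ Coloring λ ρ → Satisfiable (AgreeBelow N ρ)
    stage zero = (λ _ _ → false) , λ M → proj₁ (satisfiable M) , (λ ()) , proj₂ (satisfiable M)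
    stage (suc N) = setRow ρ N (proj₁ row) , weaken extend (proj₂ row)
      where
      ρ = proj₁ (stage N)
      row = fix-bits N (λ i ψ → ψ N i) (proj₂ (stage N))
      extend : ∀ {ψ} → AgreeBelow N ρ ψ × (∀ i → ψ N i ≡ proj₁ row i) →
               AgreeBelow (suc N) (setRow ρ N (proj₁ row)) ψ
      extend (agree , rowN) {j} j<1+N i with m<1+n⇒m<n∨m≡n j<1+N
      ... | inj₁ j<N = trans (setRow-off ρ N _ i (<⇒≢ j<N)) (agree j<N i)
      ... | inj₂ refl = trans (setRow-on ρ N _ i) (sym (rowN i))

    limit : Coloring
    limit j = proj₁ (stage (suc j)) j

    stage-limit : ∀ {N j} → j < N → (i : Fin j) → proj₁ (stage N) j i ≡ limit j i
    stage-limit {suc N} j<1+N i with m<1+n⇒m<n∨m≡n j<1+N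
    ... | inj₁ j<N = trans (setRow-off _ N _ i (<⇒≢ j<N)) (stage-limit j<N i)
    ... | inj₂ refl = refl

    compactness : ∃ λ ψ → ∀ M → C M ψ
    compactness = limit , λ M → solves M (proj₂ (local M))
      where
      solves : ∀ M {L} → (∀ {ψ ψ′} → AgreeBelow L ψ ψ′ → C M ψ → C M ψ′) → C M limit
      solves M {L} loc with proj₂ (stage L) M
      ... | ψ , agree , Cψ = loc (λ j<L i → trans (sym (agree j<L i)) (stage-limit j<L i)) Cψ

-- ψ witnesses, as far as triangles below M can tell, that φ is not reconstructible; the
-- disagreement between ψ and φ lies in row j.
RivalBelow : ℕ → Coloring → ℕ → Coloring → Set
RivalBelow M φ j ψ = SameMonoTrianglesBelow M ψ φ × ψ 1 zero ≡ φ 1 zero × ∃ λ i → ψ j i ≢ φ j i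

rivalBelow-antitone : ∀ {M M′ φ j ψ} → M ≤ M′ → RivalBelow M′ φ j ψ → RivalBelow M φ j ψ
rivalBelow-antitone M≤M′ (same , pin , diff) =
  (λ a<M b<M c<M → same (<-≤-trans a<M M≤M′) (<-≤-trans b<M M≤M′) (<-≤-trans c<M M≤M′)) ,
  pin , diff

horizon : ℕ → ℕ → ℕ
horizon j M = 2 + j + M

M≤horizon : ∀ j M → M ≤ horizon j M
M≤horizon j M = m≤n+m M (2 + j)

rivalBelow-transfer : ∀ {M φ φ′ j ψ ψ′} → AgreeBelow (horizon j M) φ φ′ →
                      AgreeBelow (horizon j M) ψ ψ′ → RivalBelow M φ j ψ → RivalBelow M φ′ j ψ′
rivalBelow-transfer {M} {j = j} agreeφ agreeψ (same , pin , i , diff) =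
  (λ a<M b<M c<M d →
     ⇔.trans (⇔.sym (monochromatic-agree agreeψ (below a<M) (below b<M) (below c<M)))
             (⇔.trans (same a<M b<M c<M d)
                      (monochromatic-agree agreeφ (below a<M) (below b<M) (below c<M)))) ,
  trans (sym (agreeψ 1<horizon zero)) (trans pin (agreeφ 1<horizon zero)) ,
  i , λ e → diff (trans (agreeψ j<horizon i) (trans e (sym (agreeφ j<horizon i))))
  where
  below : ∀ {a} → a < M → a < horizon j M
  below a<M = <-≤-trans a<M (M≤horizon j M)
  1<horizon : 1 < horizon j M
  1<horizon = s≤s (s≤s z≤n)
  j<horizon : j < horizon j M
  j<horizon = s≤s (≤-trans (m≤m+n j M) (n≤1+n _))

restrict : (N : ℕ) → Coloring → Prefix N
restrict N φ j i = φ (toℕ j) i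

agreeBelow-restrict : ∀ {N φ χ} → Cyl N (restrict N φ) χ → AgreeBelow N χ φ
agreeBelow-restrict {N} {φ} {χ} cyl j<N i = at (fromℕ< j<N) (toℕ-fromℕ< j<N) i
  where
  at : ∀ (k : Fin N) {j} → toℕ k ≡ j → (i : Fin j) → χ j i ≡ φ j i
  at k refl i = cyl k i

RivalFree : ℕ → OpenCode
RivalFree j N s = ∀ χ → Cyl N s χ → ¬ ∃ (RivalBelow N χ j)

no-rivalBelow : ExcludedMiddle 0ℓ → ∀ {φ} → ReconstructibleGiven01 φ →
                ∀ j → ∃ λ M → ¬ ∃ (RivalBelow M φ j)
no-rivalBelow em {φ} given j = ¬∀⇒∃¬ em λ rivals →
  let ψ , rival = Compactness.compactness em (λ M → RivalBelow M φ j) rivalBelow-antitone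
                    (λ M → horizon j M , rivalBelow-transfer (λ _ _ → refl)) rivals
      _ , pin , i , diff = rival 0
  in diff (given ψ (sameMonoTriangles-fromBelow (λ M → proj₁ (rival M))) pin j i)

rivalFree-restrict : ∀ {φ j M} → ¬ ∃ (RivalBelow M φ j) →
                     RivalFree j (horizon j M) (restrict (horizon j M) φ)
rivalFree-restrict {j = j} {M} none χ cyl (ψ , rival) =
  none (ψ , rivalBelow-transfer (agreeBelow-restrict cyl) (λ _ _ → refl)
              (rivalBelow-antitone (M≤horizon j M) rival))

given01-fromRivalFree : ∀ {φ} → (∀ j → InOpen (RivalFree j) φ) → ReconstructibleGiven01 φ
given01-fromRivalFree {φ} inOpen ψ same pin j i with ψ j i Bool.≟ φ j i
... | yes ψji≡φji = ψji≡φji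
... | no diff with inOpen j
...   | N , s , free , φ∈cyl = ⊥-elim (free φ φ∈cyl (ψ , (λ _ _ _ d → same d) , pin , i , diff))

reconstructible-Gδ : ExcludedMiddle 0ℓ → IsGδ Reconstructible
reconstructible-Gδ em = RivalFree , λ φ → mk⇔
  (λ rec j → let M , none = no-rivalBelow em (to reconstructible⇔given01 rec) j
             in horizon j M , restrict _ φ , rivalFree-restrict none , λ _ _ → refl)
  (λ inOpen → from reconstructible⇔given01 (given01-fromRivalFree inOpen))

mainTheorem2 : ExcludedMiddle 0ℓ → IsDense Reconstructible × IsGδ Reconstructible
mainTheorem2 em = dense , reconstructible-Gδ em
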